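{- Let $G$ be a simple undirected graph with integral weights $w(v)>0$ on its vertices, and let $(L,S,R)$ be a global minimum vertex-cut in $G$. Let $x\in L$ be any vertex, and let $S'=S\setminus N_G(x)$. Then $w(S')\leq w(L)$.
   Context: A vertex-cut of $G$ is a partition $(L,S,R)$ of $V(G)$ with $L,R\neq\emptyset$ and no edge between $L$ and $R$; its value is $w(S)=\sum_{v\in S}w(v)$, and a global minimum vertex-cut is one of minimum value. By convention $w(L)\leq w(R)$. $N_G(x)$ denotes the set of neighbors of $x$ in $G$; for a set $X$, $w(X)=\sum_{v\in X}w(v)$. -}

module Defs where

open import Data.Nat using (ℕ; zero; suc; _+_; _≤_; _<_)
open import Data.Fin using (Fin; zero; suc)
open import Data.Bool using (Bool; true; false)
open import Data.Product using (Σ; _×_; ∃-syntax)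
open import Relation.Binary.PropositionalEquality using (_≡_; _≢_)
open import Relation.Nullary using (¬_)

record Graph (n : ℕ) : Set where
  field
    adj       : Fin n → Fin n → Bool
    symmetric : ∀ u v → adj u v ≡ adj v u
    loopless  : ∀ v → adj v v ≡ false
open Graph public

record Weights (n : ℕ) : Set where
  field
    wt  : Fin n → ℕ
    pos : ∀ v → 0 < wt v
open Weights public

sumFin : ∀ {n} → (Fin n → ℕ) → ℕ
sumFin {zero}  f = 0
sumFin {suc n} f = f zero + sumFin (λ i → f (suc i))

ifIn : Bool → ℕ → ℕ
ifIn true  k = k
ifIn false _ = 0

wSet : ∀ {n} → Weights n → (Fin n → Bool) → ℕ
wSet W X = sumFin (λ v → ifIn (X v) (wt W v))

data Side : Set where
  Lside Sside Rside : Side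

isSide : Side → Side → Bool
isSide Lside Lside = true
isSide Sside Sside = true
isSide Rside Rside = true
isSide _     _     = false

Partition : ℕ → Set
Partition n = Fin n → Side

partL partS partR : ∀ {n} → Partition n → Fin n → Bool
partL P v = isSide Lside (P v)
partS P v = isSide Sside (P v)
partR P v = isSide Rside (P v)

record IsVertexCut {n} (G : Graph n) (P : Partition n) : Set where
  field
    L-nonempty : ∃[ v ] P v ≡ Lside
    R-nonempty : ∃[ v ] P v ≡ Rside
    no-LR-edge : ∀ u v → P u ≡ Lside → P v ≡ Rside → adj G u v ≡ false

record IsGlobalMinVertexCut {n} (G : Graph n) (W : Weights n) (P : Partition n) : Set where
  field
    isCut   : IsVertexCut G P
    minimal : ∀ (Q : Partition n) → IsVertexCut G Q → wSet W (partS P) ≤ wSet W (partS Q)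

_∧not_ : Bool → Bool → Bool
true ∧not false = true
_    ∧not _     = false

S-minus-N : ∀ {n} → Graph n → Partition n → Fin n → Fin n → Bool
S-minus-N G P x v = partS P v ∧not adj G x v

{-# OPTIONS --safe #-}
module Submission where

-- The star partition ({x}, N(x), V ∖ N[x]) is itself a vertex-cut: some vertex
-- of R lies outside N[x], since x ∈ L has no neighbour in R. Minimality gives
-- w(S) ≤ w(N(x)), and N(x) ⊆ (S ∩ N(x)) ∪ L. Cancelling w(S ∩ N(x)) from
-- w(S ∖ N(x)) + w(S ∩ N(x)) = w(S) ≤ w(N(x)) ≤ w(S ∩ N(x)) + w(L) leaves the claim.

open import Defs
open import Data.Nat using (ℕ; _≤_; _+_; zero; suc; z≤n)
open import Data.Nat.Properties
  using (+-mono-≤; +-cancelʳ-≤; +-comm; m≤m+n; m≤n+m;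
         +-identityʳ; +-commutativeSemigroup; module ≤-Reasoning)
open import Algebra.Properties.CommutativeSemigroup +-commutativeSemigroup using (interchange)
open import Data.Fin using (Fin; zero; suc; _≟_)
open import Data.Bool using (Bool; true; false; _∧_; if_then_else_)
open import Data.Empty using (⊥-elim)
open import Function using (case_of_)
open import Data.Product using (_,_)
open import Data.Sum using (_⊎_; inj₁; inj₂)
open import Relation.Nullary using (yes; no; contradiction)
open import Relation.Binary.PropositionalEquality using (_≡_; _≢_; refl; sym; trans; cong; cong₂; subst)

sumFin-cong : ∀ {n} {f g : Fin n → ℕ} → (∀ i → f i ≡ g i) → sumFin f ≡ sumFin g
sumFin-cong {zero}  f≗g = refl
sumFin-cong {suc n} f≗g = cong₂ _+_ (f≗g zero) (sumFin-cong (λ i → f≗g (suc i)))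

sumFin-mono-≤ : ∀ {n} {f g : Fin n → ℕ} → (∀ i → f i ≤ g i) → sumFin f ≤ sumFin g
sumFin-mono-≤ {zero}  f≤g = z≤n
sumFin-mono-≤ {suc n} f≤g = +-mono-≤ (f≤g zero) (sumFin-mono-≤ (λ i → f≤g (suc i)))

sumFin-distrib-+ : ∀ {n} (f g : Fin n → ℕ) →
                   sumFin (λ i → f i + g i) ≡ sumFin f + sumFin g
sumFin-distrib-+ {zero}  f g = refl
sumFin-distrib-+ {suc n} f g rewrite sumFin-distrib-+ (λ i → f (suc i)) (λ i → g (suc i)) =
  interchange (f zero) (g zero) _ _

ifIn-split : ∀ a b k → ifIn a k ≡ ifIn (a ∧not b) k + ifIn (a ∧ b) k
ifIn-split false b     k = refl
ifIn-split true  true  k = refl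
ifIn-split true  false k = sym (+-identityʳ k)

ifIn-cover : ∀ {a b c} k → (a ≡ true → b ≡ true ⊎ c ≡ true) →
             ifIn a k ≤ ifIn b k + ifIn c k
ifIn-cover {false}         k cover = z≤n
ifIn-cover {true}  {b} {c} k cover with cover refl
... | inj₁ refl = m≤m+n k (ifIn c k)
... | inj₂ refl = m≤n+m k (ifIn b k)

module _ {n} (W : Weights n) where

  wSet-cong : ∀ {X Y : Fin n → Bool} → (∀ v → X v ≡ Y v) → wSet W X ≡ wSet W Y
  wSet-cong X≗Y = sumFin-cong (λ v → cong (λ b → ifIn b (wt W v)) (X≗Y v))

  wSet-split : ∀ (X Y : Fin n → Bool) →
               wSet W X ≡ wSet W (λ v → X v ∧not Y v) + wSet W (λ v → X v ∧ Y v)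
  wSet-split X Y = trans (sumFin-cong (λ v → ifIn-split (X v) (Y v) (wt W v)))
                         (sumFin-distrib-+ {n} _ _)

  wSet-cover : ∀ {X Y Z : Fin n → Bool} →
               (∀ v → X v ≡ true → Y v ≡ true ⊎ Z v ≡ true) →
               wSet W X ≤ wSet W Y + wSet W Z
  wSet-cover cover = subst (wSet W _ ≤_) (sumFin-distrib-+ {n} _ _)
                            (sumFin-mono-≤ (λ v → ifIn-cover (wt W v) (cover v)))

module _ {n} (G : Graph n) (x : Fin n) where

  starPartition : Partition n
  starPartition v with x ≟ v
  ... | yes _ = Lside
  ... | no  _ = if adj G x v then Sside else Rside

  partS-starPartition : ∀ v → partS starPartition v ≡ adj G x v
  partS-starPartition v with x ≟ v
  ... | yes refl = sym (loopless G x)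
  ... | no  _ with adj G x v
  ...   | true  = refl
  ...   | false = refl

  starPartition-Lside : ∀ v → starPartition v ≡ Lside → v ≡ x
  starPartition-Lside v eq with x ≟ v
  ... | yes refl = refl
  ... | no  _ with adj G x v
  ...   | true  = case eq of λ ()
  ...   | false = case eq of λ ()

  starPartition-Rside : ∀ v → starPartition v ≡ Rside → adj G x v ≡ false
  starPartition-Rside v eq with x ≟ v
  ... | yes _ = case eq of λ ()
  ... | no  _ with adj G x v
  ...   | true  = case eq of λ ()
  ...   | false = refl

  starPartition-x : starPartition x ≡ Lside
  starPartition-x with x ≟ x
  ... | yes _  = refl
  ... | no x≢x = ⊥-elim (x≢x refl)

  starPartition-nonNeighbour : ∀ r → r ≢ x → adj G x r ≡ false → starPartition r ≡ Rside
  starPartition-nonNeighbour r r≢x x≁r with x ≟ r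
  ... | yes refl = ⊥-elim (r≢x refl)
  ... | no  _ rewrite x≁r = refl

  starPartition-isVertexCut : ∀ r → r ≢ x → adj G x r ≡ false → IsVertexCut G starPartition
  starPartition-isVertexCut r r≢x x≁r = record
    { L-nonempty = x , starPartition-x
    ; R-nonempty = r , starPartition-nonNeighbour r r≢x x≁r
    ; no-LR-edge = λ u v u∈L v∈R →
        edge-from-x (starPartition-Lside u u∈L) (starPartition-Rside v v∈R)
    }
    where
    edge-from-x : ∀ {u v} → u ≡ x → adj G x v ≡ false → adj G u v ≡ false
    edge-from-x refl x≁v = x≁v

neighbour-of-L-in-S∪L : ∀ {n} {G : Graph n} {P : Partition n} → IsVertexCut G P →
                        ∀ {x} → P x ≡ Lside → ∀ v → adj G x v ≡ true →
                        partS P v ∧ adj G x v ≡ true ⊎ partL P v ≡ true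
neighbour-of-L-in-S∪L {P = P} cut {x} x∈L v x~v with P v in Pv≡
... | Lside = inj₂ refl
... | Sside = inj₁ x~v
... | Rside = contradiction (trans (sym x~v) (IsVertexCut.no-LR-edge cut x v x∈L Pv≡)) λ ()

claim2p2 : ∀ {n : ℕ} (G : Graph n) (W : Weights n) (P : Partition n) →
    IsGlobalMinVertexCut G W P →
    wSet W (partL P) ≤ wSet W (partR P) →
    (x : Fin n) → P x ≡ Lside →
    wSet W (S-minus-N G P x) ≤ wSet W (partL P)
claim2p2 {n} G W P minCut _ x x∈L = +-cancelʳ-≤ (wSet W S∩N) _ _ (begin
  wSet W (S-minus-N G P x) + wSet W S∩N  ≡⟨ wSet-split W (partS P) (adj G x) ⟨
  wSet W (partS P)                      ≤⟨ minimal (starPartition G x) starCut ⟩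
  wSet W (partS (starPartition G x))    ≡⟨ wSet-cong W (partS-starPartition G x) ⟩
  wSet W (adj G x)                      ≤⟨ wSet-cover W (neighbour-of-L-in-S∪L isCut x∈L) ⟩
  wSet W S∩N + wSet W (partL P)         ≡⟨ +-comm (wSet W S∩N) _ ⟩
  wSet W (partL P) + wSet W S∩N         ∎)
  where
  open IsGlobalMinVertexCut minCut
  open IsVertexCut isCut
  open ≤-Reasoning
  S∩N : Fin n → Bool
  S∩N v = partS P v ∧ adj G x v
  starCut : IsVertexCut G (starPartition G x)
  starCut with R-nonempty
  ... | r , r∈R = starPartition-isVertexCut G x r
                    (λ { refl → contradiction (trans (sym x∈L) r∈R) λ () })
                    (no-LR-edge x r x∈L r∈R)
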